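{- Consider the generalized Sudoku problem with data $n, \pi_1, \pi_2, \pi_3, i_1, \ldots, i_k, g_{i_1}, \ldots, g_{i_k}$ and solution set $S(n,g)$. Let $x, y \in S(n, g)$ and let $r \in \{1, 2, 3\}$. Then there exists a permutation $\tau$ of $\{1, \ldots, n^2\}$ such that (i) $y = \tau(x)$; (ii) $\tau$ is $\pi_r$-consistent; (iii) $\tau$ is $\pi_s$-$x$-consistent for $s = 1, 2, 3$; and (iv) $\tau(i_l) = i_l$ for $l = 1, \ldots, k$.
   Context: For $y \in \mathbb{Z}^s$ write $y <> \mathbf{0}$ if every component of $y$ is nonzero. Let $n \ge 2$ and $s(n) = \sum_{i=1}^{n-1} i$. The $s(n) \times n$ matrix $A(n)$ is defined inductively: $A(1)$ is the empty matrix, and $A(m) = \begin{pmatrix} \mathbf{1}_{m-1} & -U_{m-1} \\ \mathbf{0}_{s(m-1)} & A(m-1) \end{pmatrix}$, where $\mathbf{1}_{m-1}$ is the all-ones column, $U_{m-1}$ the identity matrix and $\mathbf{0}_{s(m-1)}$ the zero column of length $s(m-1)$. Let $A$ be the $(n \cdot s(n)) \times n^2$ block-diagonal matrix whose $n$ diagonal blocks all equal $A(n)$. For a permutation $\pi$ of $\{1,\ldots,n^2\}$, $A_\pi$ is the matrix whose $j$-th column is the $\pi^{ -1}(j)$-th column of $A$. For a permutation $\tau$ and $x \in \mathbb{Z}^{n^2}$, $\tau(x) = (x_{\tau^{ -1}(1)}, \ldots, x_{\tau^{ -1}(n^2)})^T$. The constraint sets of $\pi$ are $cs_\pi(j) =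 \{\pi(i) \mid (j-1)n + 1 \le i \le jn\}$, $j=1,\ldots,n$. A permutation $\tau$ is $\pi$-consistent if $\tau(cs_\pi(j)) = cs_\pi(j)$ for all $j$, and $\pi$-$x$-consistent if $\{x_{\tau^{ -1}(i)} \mid i \in cs_\pi(j)\} = \{x_i \mid i \in cs_\pi(j)\}$ for all $j$. Generalized Sudoku problem: given permutations $\pi_1, \pi_2, \pi_3$ of $\{1, \ldots, n^2\}$, an integer $0 \le k \le n^2$, an index set $\{i_1, \ldots, i_k\} \subset \{1, \ldots, n^2\}$ and givens $g_{i_l} \in \mathbb{Z}$ with $1 \le g_{i_l} \le n$, its solution set is $S(n,g) = \{x \in \mathbb{Z}^{n^2} \mid 1 \le x_i \le n \ (i = 1,\ldots,n^2),\ A_{\pi_r}x <> \mathbf{0}\ (r = 1,2,3),\ x_{i_l} = g_{i_l}\ (l = 1, \ldots, k)\}$. -}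

module Defs where

open import Data.Nat using (ℕ; zero; suc; _+_; _*_)
open import Data.Fin using (Fin; zero; suc; splitAt; remQuot; combine; _≟_)
open import Data.Fin.Permutation using (Permutation′; _⟨$⟩ʳ_; _⟨$⟩ˡ_)
open import Data.Integer using (ℤ; 0ℤ; 1ℤ; -_; +_) renaming (_+_ to _+ℤ_; _*_ to _*ℤ_; _≤_ to _≤ℤ_)
open import Data.Product using (_×_; _,_; ∃-syntax)
open import Data.Sum using (inj₁; inj₂)
open import Relation.Nullary using (¬_; yes; no)
open import Relation.Binary.PropositionalEquality using (_≡_)
open import Function.Bundles using (_⇔_)

s : ℕ → ℕ
s zero    = 0
s (suc m) = m + s m

Σℤ : (N : ℕ) → (Fin N → ℤ) → ℤ
Σℤ zero    f = 0ℤ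
Σℤ (suc N) f = f zero +ℤ Σℤ N (λ i → f (suc i))

U : (m : ℕ) → Fin m → Fin m → ℤ
U m i j with i ≟ j
... | yes _ = 1ℤ
... | no  _ = 0ℤ

-- A(m) : s(m) × m matrix, defined inductively:
-- A(m+1) = ( 1_m  | -U_m ; 0_{s(m)} | A(m) ); A(0), A(1) empty.
Amat : (m : ℕ) → Fin (s m) → Fin m → ℤ
Amat zero    ()
Amat (suc m) row col with splitAt m row | col
... | inj₁ i | zero    = 1ℤ
... | inj₁ i | suc j   = - U m i j
... | inj₂ k | zero    = 0ℤ
... | inj₂ k | suc j   = Amat m k j

-- Block-diagonal (n·s(n)) × n² matrix with n diagonal blocks A(n).
-- Row index combine b r  (block b, row r within block); column combine c j.
Ablock : (n : ℕ) → Fin (n * s n) → Fin (n * n) → ℤ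
Ablock n row col with remQuot {n} (s n) row | remQuot {n} n col
... | (b , r) | (c , j) with b ≟ c
...   | yes _ = Amat n r j
...   | no  _ = 0ℤ

Aπ : (n : ℕ) → Permutation′ (n * n) → Fin (n * s n) → Fin (n * n) → ℤ
Aπ n π row j = Ablock n row (π ⟨$⟩ˡ j)

mulMV : ∀ {R C} → (Fin R → Fin C → ℤ) → (Fin C → ℤ) → Fin R → ℤ
mulMV {C = C} M x r = Σℤ C (λ j → M r j *ℤ x j)

_<>0 : ∀ {R} → (Fin R → ℤ) → Set
_<>0 {R} y = ∀ (i : Fin R) → ¬ (y i ≡ 0ℤ)

actP : ∀ {N} → Permutation′ N → (Fin N → ℤ) → Fin N → ℤ
actP τ x i = x (τ ⟨$⟩ˡ i)

-- solution set S(n,g)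
-- givens: k, injective index map idx : Fin k → Fin (n*n), values g
InS : (n : ℕ) (π₁ π₂ π₃ : Permutation′ (n * n)) (k : ℕ)
      (idx : Fin k → Fin (n * n)) (g : Fin k → ℤ) (x : Fin (n * n) → ℤ) → Set
InS n π₁ π₂ π₃ k idx g x =
  (∀ i → (1ℤ ≤ℤ x i) × (x i ≤ℤ + n)) ×
  (mulMV (Aπ n π₁) x) <>0 × (mulMV (Aπ n π₂) x) <>0 × (mulMV (Aπ n π₃) x) <>0 ×
  (∀ l → x (idx l) ≡ g l)

-- i ∈ cs_π(j) = { π(i') | (j-1)n+1 ≤ i' ≤ jn }
InCs : (n : ℕ) → Permutation′ (n * n) → Fin n → Fin (n * n) → Set
InCs n π j i = ∃[ t ] (π ⟨$⟩ʳ combine {n} {n} j t ≡ i)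

Consistent : (n : ℕ) → Permutation′ (n * n) → Permutation′ (n * n) → Set
Consistent n π τ = ∀ (j : Fin n) →
  (∀ i → InCs n π j i → InCs n π j (τ ⟨$⟩ʳ i)) ×
  (∀ i → InCs n π j i → ∃[ i′ ] (InCs n π j i′ × τ ⟨$⟩ʳ i′ ≡ i))

XConsistent : (n : ℕ) → Permutation′ (n * n) → (Fin (n * n) → ℤ) → Permutation′ (n * n) → Set
XConsistent n π x τ = ∀ (j : Fin n) (v : ℤ) →
  (∃[ i ] (InCs n π j i × x (τ ⟨$⟩ˡ i) ≡ v)) ⇔ (∃[ i ] (InCs n π j i × x i ≡ v))

-- π_r for r ∈ {1,2,3} (r = zero, suc zero, suc (suc zero))
pick : ∀ {A : Set} → A → A → A → Fin 3 → A
pick a b c zero             = a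
pick a b c (suc zero)       = b
pick a b c (suc (suc zero)) = c

module Submission where

-- If row r of A(n) has +1 in column a and −1 in column b, then row
-- (j, r) of A_π applied to x is x(c_a) − x(c_b), where c_a, c_b are the a-th
-- and b-th cells of the j-th constraint set of π.  So A_π x <> 0 says that x is
-- injective on every constraint set of π; having n cells and values in
-- {1..n}, x then takes every value of {1..n} exactly once there.  On the j-th
-- constraint set of π_r there is hence a permutation ρ_j with y ∘ ρ_j = x;
-- gluing the ρ_j gives τ.  It is π_r-consistent by construction; it is
-- π_s-x-consistent because x and y = τ(x) both take all values {1..n} on each
-- constraint set of π_s; and it fixes a given because x and y agree there.
--
-- The argument works for every n.

open import Defs
open import Data.Nat using (ℕ; zero; suc; _*_; _≤_; _∸_; s≤s)
open import Data.Nat.Properties using (n<1+n)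
open import Data.Fin using (Fin; zero; suc; combine; remQuot; quotRem; toℕ; punchOut; _<_; _↑ˡ_; _↑ʳ_)
  renaming (_≟_ to _≟ᶠ_)
open import Data.Fin.Properties
  using (suc-injective; remQuot-combine; combine-remQuot; splitAt-↑ˡ; splitAt-↑ʳ; <-cmp; <⇒≢; any?; pigeonhole; punchOut-injective)
open import Data.Fin.Permutation using (Permutation′; _⟨$⟩ʳ_; _⟨$⟩ˡ_; permutation; inverseˡ; inverseʳ)
open import Data.Integer using (ℤ; 0ℤ; 1ℤ; -1ℤ; +_; ∣_∣; _-_; +≤+)
  renaming (_≤_ to _≤ℤ_; _+_ to _+ℤ_; _*_ to _*ℤ_)
import Data.Integer.Properties as ℤ
open import Data.Product using (_×_; _,_; proj₁; proj₂; ∃-syntax; ∃₂)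
open import Data.Empty using (⊥-elim)
open import Function.Definitions using (Injective)
open import Function.Bundles using (mk⇔)
open import Relation.Nullary using (yes; no)
open import Relation.Binary using (tri<; tri≈; tri>)
open import Relation.Binary.PropositionalEquality
  using (_≡_; _≢_; refl; sym; trans; cong; cong₂; module ≡-Reasoning)

InRange : ℕ → ℤ → Set
InRange n v = (1ℤ ≤ℤ v) × (v ≤ℤ + n)

Σ-zero : ∀ N (f : Fin N → ℤ) → (∀ c → f c ≡ 0ℤ) → Σℤ N f ≡ 0ℤ
Σ-zero zero    f f≡0 = refl
Σ-zero (suc N) f f≡0
  rewrite f≡0 zero | Σ-zero N (λ c → f (suc c)) (λ c → f≡0 (suc c)) = refl

Σ-one : ∀ N (f : Fin N → ℤ) p → (∀ c → c ≢ p → f c ≡ 0ℤ) → Σℤ N f ≡ f p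
Σ-one (suc N) f zero    f≡0
  rewrite Σ-zero N (λ c → f (suc c)) (λ c → f≡0 (suc c) (λ ())) = ℤ.+-identityʳ (f zero)
Σ-one (suc N) f (suc p) f≡0
  rewrite f≡0 zero (λ ())
        | Σ-one N (λ c → f (suc c)) p (λ c c≢p → f≡0 (suc c) (λ e → c≢p (suc-injective e)))
  = ℤ.+-identityˡ (f (suc p))

Σ-two : ∀ N (f : Fin N → ℤ) p q → p ≢ q → (∀ c → c ≢ p → c ≢ q → f c ≡ 0ℤ) →
        Σℤ N f ≡ f p +ℤ f q
Σ-two (suc N) f zero    zero    p≢q f≡0 = ⊥-elim (p≢q refl)
Σ-two (suc N) f zero    (suc q) p≢q f≡0
  rewrite Σ-one N (λ c → f (suc c)) q (λ c c≢q → f≡0 (suc c) (λ ()) (λ e → c≢q (suc-injective e)))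
  = refl
Σ-two (suc N) f (suc p) zero    p≢q f≡0
  rewrite Σ-one N (λ c → f (suc c)) p (λ c c≢p → f≡0 (suc c) (λ e → c≢p (suc-injective e)) (λ ()))
  = ℤ.+-comm (f zero) (f (suc p))
Σ-two (suc N) f (suc p) (suc q) p≢q f≡0
  rewrite f≡0 zero (λ ()) (λ ())
        | Σ-two N (λ c → f (suc c)) p q (λ e → p≢q (cong suc e))
            (λ c c≢p c≢q → f≡0 (suc c) (λ e → c≢p (suc-injective e)) (λ e → c≢q (suc-injective e)))
  = ℤ.+-identityˡ _

U-diagonal : ∀ m (i : Fin m) → U m i i ≡ 1ℤ
U-diagonal m i with i ≟ᶠ i
... | yes _   = refl
... | no  i≢i = ⊥-elim (i≢i refl)

U-offDiagonal : ∀ m (i j : Fin m) → i ≢ j → U m i j ≡ 0ℤ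
U-offDiagonal m i j i≢j with i ≟ᶠ j
... | yes i≡j = ⊥-elim (i≢j i≡j)
... | no  _   = refl

DifferenceRow : ∀ m → Fin (s m) → Fin m → Fin m → Set
DifferenceRow m r a b =
  (Amat m r a ≡ 1ℤ) × (Amat m r b ≡ -1ℤ) × (∀ c → c ≢ a → c ≢ b → Amat m r c ≡ 0ℤ)

-- A(m) contains e_a − e_b for every pair a < b; this is what makes A(m)y <> 0
-- express that y has pairwise distinct entries.
Amat-differenceRow : ∀ m (a b : Fin m) → a < b → ∃[ r ] DifferenceRow m r a b
Amat-differenceRow (suc m) zero (suc b) _ = b ↑ˡ s m , one , minusOne , rest
  where
  one : Amat (suc m) (b ↑ˡ s m) zero ≡ 1ℤ
  one rewrite splitAt-↑ˡ m b (s m) = refl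
  minusOne : Amat (suc m) (b ↑ˡ s m) (suc b) ≡ -1ℤ
  minusOne rewrite splitAt-↑ˡ m b (s m) | U-diagonal m b = refl
  rest : ∀ c → c ≢ zero → c ≢ suc b → Amat (suc m) (b ↑ˡ s m) c ≡ 0ℤ
  rest zero    c≢0 _    = ⊥-elim (c≢0 refl)
  rest (suc c) _   c≢sb
    rewrite splitAt-↑ˡ m b (s m) | U-offDiagonal m b c (λ e → c≢sb (cong suc (sym e))) = refl
Amat-differenceRow (suc m) (suc a) (suc b) (s≤s a<b)
  with r , one , minusOne , rest ← Amat-differenceRow m a b a<b
  = m ↑ʳ r , one′ , minusOne′ , rest′
  where
  one′ : Amat (suc m) (m ↑ʳ r) (suc a) ≡ 1ℤ
  one′ rewrite splitAt-↑ʳ m (s m) r = one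
  minusOne′ : Amat (suc m) (m ↑ʳ r) (suc b) ≡ -1ℤ
  minusOne′ rewrite splitAt-↑ʳ m (s m) r = minusOne
  rest′ : ∀ c → c ≢ suc a → c ≢ suc b → Amat (suc m) (m ↑ʳ r) c ≡ 0ℤ
  rest′ zero    _ _ rewrite splitAt-↑ʳ m (s m) r = refl
  rest′ (suc c) c≢a c≢b rewrite splitAt-↑ʳ m (s m) r =
    rest c (λ e → c≢a (cong suc e)) (λ e → c≢b (cong suc e))

blockEntry : ∀ n → Fin n × Fin (s n) → Fin n × Fin n → ℤ
blockEntry n (b , r) (c , j) with b ≟ᶠ c
... | yes _ = Amat n r j
... | no  _ = 0ℤ

Ablock-blockEntry : ∀ n row col →
  Ablock n row col ≡ blockEntry n (remQuot {n} (s n) row) (remQuot {n} n col)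
Ablock-blockEntry n row col with quotRem {n} (s n) row | quotRem {n} n col
... | (_ , b) | (_ , c) with b ≟ᶠ c
...   | yes _ = refl
...   | no  _ = refl

Ablock-combine : ∀ n (j j′ : Fin n) r c → Ablock n (combine j r) (combine j′ c) ≡ blockEntry n (j , r) (j′ , c)
Ablock-combine n j j′ r c = trans (Ablock-blockEntry n (combine j r) (combine j′ c))
  (cong₂ (blockEntry n) (remQuot-combine {n} {s n} j r) (remQuot-combine {n} {n} j′ c))

Ablock-diagonal : ∀ n (j : Fin n) r c → Ablock n (combine j r) (combine j c) ≡ Amat n r c
Ablock-diagonal n j r c = trans (Ablock-combine n j j r c) diagonal
  where
  diagonal : blockEntry n (j , r) (j , c) ≡ Amat n r c
  diagonal with j ≟ᶠ j
  ... | yes _   = refl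
  ... | no  j≢j = ⊥-elim (j≢j refl)

Ablock-offDiagonal : ∀ n (j j′ : Fin n) r c → j ≢ j′ → Ablock n (combine j r) (combine j′ c) ≡ 0ℤ
Ablock-offDiagonal n j j′ r c j≢j′ = trans (Ablock-combine n j j′ r c) offDiagonal
  where
  offDiagonal : blockEntry n (j , r) (j′ , c) ≡ 0ℤ
  offDiagonal with j ≟ᶠ j′
  ... | yes j≡j′ = ⊥-elim (j≢j′ j≡j′)
  ... | no  _    = refl

cell : ∀ {n} → Permutation′ (n * n) → Fin n → Fin n → Fin (n * n)
cell {n} P j t = P ⟨$⟩ʳ combine j t

cell-cases : ∀ {n} (P : Permutation′ (n * n)) z → ∃₂ λ j t → cell P j t ≡ z
cell-cases {n} P z = proj₁ jt , proj₂ jt , (begin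
  P ⟨$⟩ʳ combine (proj₁ jt) (proj₂ jt) ≡⟨ cong (P ⟨$⟩ʳ_) (combine-remQuot {n} n (P ⟨$⟩ˡ z)) ⟩
  P ⟨$⟩ʳ (P ⟨$⟩ˡ z)                     ≡⟨ inverseʳ P ⟩
  z                                     ∎)
  where
  open ≡-Reasoning
  jt = remQuot {n} n (P ⟨$⟩ˡ z)

coords-cell : ∀ {n} (P : Permutation′ (n * n)) j t → remQuot {n} n (P ⟨$⟩ˡ cell P j t) ≡ (j , t)
coords-cell {n} P j t = trans (cong (remQuot {n} n) (inverseˡ P)) (remQuot-combine {n} {n} j t)

cell-injective : ∀ {n} (P : Permutation′ (n * n)) j {t t′} → cell P j t ≡ cell P j t′ → t ≡ t′
cell-injective {n} P j {t} {t′} e = cong proj₂ (begin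
  (j , t)                        ≡⟨ coords-cell P j t ⟨
  remQuot n (P ⟨$⟩ˡ cell P j t)  ≡⟨ cong (λ z → remQuot {n} n (P ⟨$⟩ˡ z)) e ⟩
  remQuot n (P ⟨$⟩ˡ cell P j t′) ≡⟨ coords-cell P j t′ ⟩
  (j , t′)                       ∎)
  where open ≡-Reasoning

Aπ-cell : ∀ n (P : Permutation′ (n * n)) row (j′ t : Fin n) → Aπ n P row (cell P j′ t) ≡ Ablock n row (combine j′ t)
Aπ-cell n P row j′ t = cong (Ablock n row) (inverseˡ P)

Aπ-differenceRow : ∀ n (P : Permutation′ (n * n)) (x : Fin (n * n) → ℤ) j (a b : Fin n) → a < b →
  ∃[ row ] mulMV (Aπ n P) x row ≡ x (cell P j a) - x (cell P j b)
Aπ-differenceRow n P x j a b a<b with r , one , minusOne , rest ← Amat-differenceRow n a b a<b =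
  combine j r , (begin
    Σℤ (n * n) term       ≡⟨ Σ-two (n * n) term p q p≢q vanishes ⟩
    term p +ℤ term q      ≡⟨ cong₂ _+ℤ_ (cong (_*ℤ x p) (entry a one)) (cong (_*ℤ x q) (entry b minusOne)) ⟩
    1ℤ *ℤ x p +ℤ -1ℤ *ℤ x q ≡⟨ cong₂ _+ℤ_ (ℤ.*-identityˡ (x p)) (ℤ.-1*i≡-i (x q)) ⟩
    x p - x q             ∎)
  where
  open ≡-Reasoning
  p = cell P j a
  q = cell P j b
  term : Fin (n * n) → ℤ
  term c = Aπ n P (combine j r) c *ℤ x c
  p≢q : p ≢ q
  p≢q e = <⇒≢ a<b (cell-injective P j e)
  entry : ∀ t {v} → Amat n r t ≡ v → Aπ n P (combine j r) (cell P j t) ≡ v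
  entry t e = trans (Aπ-cell n P _ j t) (trans (Ablock-diagonal n j r t) e)
  vanishes : ∀ c → c ≢ p → c ≢ q → term c ≡ 0ℤ
  vanishes c c≢p c≢q with cell-cases {n} P c
  ... | j′ , t , refl with j ≟ᶠ j′
  ...   | no j≢j′ = cong (_*ℤ x c) (trans (Aπ-cell n P _ j′ t) (Ablock-offDiagonal n j j′ r t j≢j′))
  ...   | yes refl = cong (_*ℤ x c)
            (entry t (rest t (λ e → c≢p (cong (cell P j) e)) (λ e → c≢q (cong (cell P j) e))))

injective-on-constraintSets : ∀ n (P : Permutation′ (n * n)) (x : Fin (n * n) → ℤ) →
  mulMV (Aπ n P) x <>0 → ∀ j → Injective _≡_ _≡_ (λ t → x (cell P j t))
injective-on-constraintSets n P x nonzero j {a} {b} e with <-cmp a b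
... | tri≈ _ a≡b _ = a≡b
... | tri< a<b _ _ with row , eq ← Aπ-differenceRow n P x j a b a<b =
  ⊥-elim (nonzero row (trans eq (ℤ.i≡j⇒i-j≡0 e)))
... | tri> _ _ b<a with row , eq ← Aπ-differenceRow n P x j b a b<a =
  ⊥-elim (nonzero row (trans eq (ℤ.i≡j⇒i-j≡0 (sym e))))

-- An injective endomap of Fin N is surjective: if v were missed, punching v
-- out would give an injective map Fin (suc M) → Fin M, against pigeonhole.
injective⇒surjective : ∀ N (f : Fin N → Fin N) → Injective _≡_ _≡_ f → ∀ v → ∃[ t ] f t ≡ v
injective⇒surjective (suc N) f f-inj v with any? (λ t → f t ≟ᶠ v)
... | yes hit = hit
... | no miss with a , b , a<b , e ← pigeonhole (n<1+n N) (λ t → punchOut {j = f t} (λ e → miss (t , sym e)))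
  = ⊥-elim (<⇒≢ a<b (f-inj (punchOut-injective (λ e → miss (a , sym e)) (λ e → miss (b , sym e)) e)))

-- Truncating embedding ℕ → Fin (suc n), the identity below n.
clamp : ∀ n → ℕ → Fin (suc n)
clamp n       zero    = zero
clamp zero    (suc m) = zero
clamp (suc n) (suc m) = suc (clamp n m)

toℕ-clamp : ∀ n m → m ≤ n → toℕ (clamp n m) ≡ m
toℕ-clamp n       zero    _         = refl
toℕ-clamp (suc n) (suc m) (s≤s m≤n) = cong suc (toℕ-clamp n m m≤n)

code : ∀ n → ℤ → Fin (suc n)
code n v = clamp n (∣ v ∣ ∸ 1)

inRange-suc : ∀ n v → InRange (suc n) v → ∃[ m ] (m ≤ n × v ≡ + suc m)
inRange-suc n (+ zero)  (+≤+ () , _)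
inRange-suc n (+ suc m) (_ , +≤+ (s≤s m≤n)) = m , m≤n , refl

code-injective : ∀ n {u v} → InRange (suc n) u → InRange (suc n) v → code n u ≡ code n v → u ≡ v
code-injective n {u} {v} u∈ v∈ e
  with m , m≤n , refl ← inRange-suc n u u∈ | m′ , m′≤n , refl ← inRange-suc n v v∈ =
  cong (λ k → + suc k) (trans (sym (toℕ-clamp n m m≤n)) (trans (cong toℕ e) (toℕ-clamp n m′ m′≤n)))

bounded-injective⇒onto : ∀ n (f : Fin n → ℤ) → Injective _≡_ _≡_ f → (∀ t → InRange n (f t)) →
  ∀ v → InRange n v → ∃[ t ] f t ≡ v
bounded-injective⇒onto zero    f _     _   v (1≤v , v≤0) with +≤+ () ← ℤ.≤-trans 1≤v v≤0
bounded-injective⇒onto (suc n) f f-inj f∈ v v∈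
  with t , e ← injective⇒surjective (suc n) (λ t → code n (f t))
                 (λ e → f-inj (code-injective n (f∈ _) (f∈ _) e)) (code n v)
  = t , code-injective n (f∈ t) v∈ e

matching : ∀ n (f g : Fin n → ℤ) → Injective _≡_ _≡_ f → Injective _≡_ _≡_ g →
  (∀ t → InRange n (f t)) → (∀ t → InRange n (g t)) →
  ∃[ ρ ] (∀ t → g (ρ ⟨$⟩ʳ t) ≡ f t)
matching n f g f-inj g-inj f∈ g∈ =
  permutation to from (λ t → g-inj (trans (to-spec (from t)) (from-spec t)))
                      (λ t → f-inj (trans (from-spec (to t)) (to-spec t))) ,
  to-spec
  where
  to : Fin n → Fin n
  to t = proj₁ (bounded-injective⇒onto n g g-inj g∈ (f t) (f∈ t))
  to-spec : ∀ t → g (to t) ≡ f t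
  to-spec t = proj₂ (bounded-injective⇒onto n g g-inj g∈ (f t) (f∈ t))
  from : Fin n → Fin n
  from t = proj₁ (bounded-injective⇒onto n f f-inj f∈ (g t) (g∈ t))
  from-spec : ∀ t → f (from t) ≡ g t
  from-spec t = proj₂ (bounded-injective⇒onto n f f-inj f∈ (g t) (g∈ t))

module Glue {n} (P : Permutation′ (n * n)) (ρ : Fin n → Permutation′ n) where

  within : (Fin n → Fin n → Fin n) → Fin (n * n) → Fin (n * n)
  within h z = cell P (proj₁ jt) (h (proj₁ jt) (proj₂ jt))
    where jt = remQuot {n} n (P ⟨$⟩ˡ z)

  within-cell : ∀ h j t → within h (cell P j t) ≡ cell P j (h j t)
  within-cell h j t = cong (λ jt → cell P (proj₁ jt) (h (proj₁ jt) (proj₂ jt))) (coords-cell P j t)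

  within-inverse : ∀ (h k : Fin n → Fin n → Fin n) → (∀ j t → h j (k j t) ≡ t) →
    ∀ z → within h (within k z) ≡ z
  within-inverse h k hk z with j , t , refl ← cell-cases {n} P z = begin
    within h (within k (cell P j t)) ≡⟨ cong (within h) (within-cell k j t) ⟩
    within h (cell P j (k j t))      ≡⟨ within-cell h j (k j t) ⟩
    cell P j (h j (k j t))           ≡⟨ cong (cell P j) (hk j t) ⟩
    cell P j t                       ∎
    where open ≡-Reasoning

  glued : Permutation′ (n * n)
  glued = permutation (within forward) (within backward)
    (within-inverse forward backward (λ j t → inverseʳ (ρ j)))
    (within-inverse backward forward (λ j t → inverseˡ (ρ j)))
    where
    forward backward : Fin n → Fin n → Fin n
    forward  j t = ρ j ⟨$⟩ʳ t
    backward j t = ρ j ⟨$⟩ˡ t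

  glued-cell : ∀ j t → glued ⟨$⟩ʳ cell P j t ≡ cell P j (ρ j ⟨$⟩ʳ t)
  glued-cell = within-cell (λ j → ρ j ⟨$⟩ʳ_)

  glued⁻¹-cell : ∀ j t → glued ⟨$⟩ˡ cell P j t ≡ cell P j (ρ j ⟨$⟩ˡ t)
  glued⁻¹-cell = within-cell (λ j → ρ j ⟨$⟩ˡ_)

  glued-consistent : Consistent n P glued
  glued-consistent j = (λ { _ (t , refl) → ρ j ⟨$⟩ʳ t , sym (glued-cell j t) })
                     , (λ { _ (t , refl) → cell P j (ρ j ⟨$⟩ˡ t) , (ρ j ⟨$⟩ˡ t , refl)
                                         , trans (glued-cell j _) (cong (cell P j) (inverseʳ (ρ j))) })

Satisfies : ∀ n → Permutation′ (n * n) → (Fin (n * n) → ℤ) → Set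
Satisfies n P x = (∀ i → InRange n (x i)) × mulMV (Aπ n P) x <>0

matchingPermutation : ∀ n (P : Permutation′ (n * n)) (x y : Fin (n * n) → ℤ) →
  Satisfies n P x → Satisfies n P y →
  ∃[ τ ] ((∀ i → y i ≡ actP τ x i) × Consistent n P τ × (∀ i → x i ≡ y i → τ ⟨$⟩ʳ i ≡ i))
matchingPermutation n P x y (x∈ , x-ok) (y∈ , y-ok) = glued , relabels , glued-consistent , fixes
  where
  x-inj : ∀ j → Injective _≡_ _≡_ (λ t → x (cell P j t))
  x-inj = injective-on-constraintSets n P x x-ok
  y-inj : ∀ j → Injective _≡_ _≡_ (λ t → y (cell P j t))
  y-inj = injective-on-constraintSets n P y y-ok
  ρ : Fin n → Permutation′ n
  ρ j = proj₁ (matching n _ _ (x-inj j) (y-inj j) (λ t → x∈ _) (λ t → y∈ _))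
  ρ-spec : ∀ j t → y (cell P j (ρ j ⟨$⟩ʳ t)) ≡ x (cell P j t)
  ρ-spec j = proj₂ (matching n _ _ (x-inj j) (y-inj j) (λ t → x∈ _) (λ t → y∈ _))
  open Glue P ρ
  relabels : ∀ i → y i ≡ x (glued ⟨$⟩ˡ i)
  relabels i with j , t , refl ← cell-cases {n} P i = begin
    y (cell P j t)                        ≡⟨ cong (λ u → y (cell P j u)) (inverseʳ (ρ j)) ⟨
    y (cell P j (ρ j ⟨$⟩ʳ (ρ j ⟨$⟩ˡ t)))  ≡⟨ ρ-spec j _ ⟩
    x (cell P j (ρ j ⟨$⟩ˡ t))             ≡⟨ cong x (glued⁻¹-cell j t) ⟨
    x (glued ⟨$⟩ˡ cell P j t)             ∎
    where open ≡-Reasoning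
  fixes : ∀ i → x i ≡ y i → glued ⟨$⟩ʳ i ≡ i
  fixes i x≡y with j , t , refl ← cell-cases {n} P i =
    trans (glued-cell j t) (cong (cell P j) (y-inj j (trans (ρ-spec j t) x≡y)))

Occurs : ∀ n → Permutation′ (n * n) → (Fin (n * n) → ℤ) → Fin n → ℤ → Set
Occurs n Q x j v = ∃[ i ] (InCs n Q j i × x i ≡ v)

-- A value of y ∈ {1..n} occurs in x on every constraint set of Q, since x is
-- injective there; so two solutions take the same values on each of them.
occurs-transfer : ∀ n (Q : Permutation′ (n * n)) (x y : Fin (n * n) → ℤ) →
  Satisfies n Q x → (∀ i → InRange n (y i)) → ∀ j v → Occurs n Q y j v → Occurs n Q x j v
occurs-transfer n Q x y (x∈ , x-ok) y∈ j _ (i , _ , refl)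
  with t , e ← bounded-injective⇒onto n _ (injective-on-constraintSets n Q x x-ok j) (λ t → x∈ _) (y i) (y∈ i)
  = cell Q j t , (t , refl) , e

relabelling-xConsistent : ∀ n (Q τ : Permutation′ (n * n)) (x y : Fin (n * n) → ℤ) →
  Satisfies n Q x → Satisfies n Q y → (∀ i → y i ≡ actP τ x i) → XConsistent n Q x τ
relabelling-xConsistent n Q τ x y x-sol y-sol relabels j v = mk⇔
  (λ { (i , i∈ , e) → occurs-transfer n Q x y x-sol (proj₁ y-sol) j v (i , i∈ , trans (relabels i) e) })
  (λ occ → let (i , i∈ , e) = occurs-transfer n Q y x y-sol (proj₁ x-sol) j v occ
           in i , i∈ , trans (sym (relabels i)) e)

pick-elim : ∀ {A : Set} (R : A → Set) {a b c} → R a → R b → R c → ∀ r → R (pick a b c r)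
pick-elim R ra rb rc zero             = ra
pick-elim R ra rb rc (suc zero)       = rb
pick-elim R ra rb rc (suc (suc zero)) = rc

lemma4p4 : (n : ℕ) → 2 ≤ n → (π₁ π₂ π₃ : Permutation′ (n * n)) →
    (k : ℕ) → k ≤ n * n → (idx : Fin k → Fin (n * n)) → Injective _≡_ _≡_ idx →
    (g : Fin k → ℤ) → (∀ l → (1ℤ ≤ℤ g l) × (g l ≤ℤ + n)) →
    (x y : Fin (n * n) → ℤ) →
    InS n π₁ π₂ π₃ k idx g x → InS n π₁ π₂ π₃ k idx g y →
    (r : Fin 3) →
    ∃[ τ ] ((∀ i → y i ≡ actP τ x i) ×
            Consistent n (pick π₁ π₂ π₃ r) τ ×
            XConsistent n π₁ x τ × XConsistent n π₂ x τ × XConsistent n π₃ x τ ×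
            (∀ l → τ ⟨$⟩ʳ idx l ≡ idx l))
lemma4p4 n _ π₁ π₂ π₃ k _ idx _ g _ x y (x∈ , x₁ , x₂ , x₃ , x-givens) (y∈ , y₁ , y₂ , y₃ , y-givens) r
  with τ , relabels , consistent , fixes ←
         matchingPermutation n (pick π₁ π₂ π₃ r) x y
           (x∈ , pick-elim (λ P → mulMV (Aπ n P) x <>0) x₁ x₂ x₃ r)
           (y∈ , pick-elim (λ P → mulMV (Aπ n P) y <>0) y₁ y₂ y₃ r)
  = τ , relabels , consistent
  , relabelling-xConsistent n π₁ τ x y (x∈ , x₁) (y∈ , y₁) relabels
  , relabelling-xConsistent n π₂ τ x y (x∈ , x₂) (y∈ , y₂) relabels
  , relabelling-xConsistent n π₃ τ x y (x∈ , x₃) (y∈ , y₃) relabels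
  , λ l → fixes (idx l) (trans (x-givens l) (sym (y-givens l)))
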